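{- For every integer $n\ge 1$, the polynomials $P_n$ defined in the context satisfy $$P_n(q;x_1,\dots,x_n)=\sum_{i=1}^{n} x_i^{\,n-i}\,P_{n-1}\bigl(q;\,x_1,\dots,x_{i-1},\,q x_{i+1},\dots,q x_n\bigr),$$ where $P_0:=1$. That is, the $(n-1)$ arguments after $q$ in the $i$-th summand are $x_1,\dots,x_{i-1}$ followed by $qx_{i+1},\dots,qx_n$.
   Context: For a permutation $\pi=\pi_1\cdots\pi_n$ of $\{1,\dots,n\}$ and a pattern $\sigma\in S_k$, let $N_\sigma(\pi)$ be the number of index tuples $1\le i_1<\dots<i_k\le n$ such that $\pi_{i_1},\dots,\pi_{i_k}$ are in the same relative order as $\sigma_1,\dots,\sigma_k$. For $\pi\in S_n$ define $$\mathrm{weight}(\pi)=q^{N_{[1,2,3]}(\pi)}\prod_{i=1}^n x_i^{|\{1\le a<b\le n:\ \pi_a=i<\pi_b\}|},$$ and $P_n(q;x_1,\dots,x_n)=\sum_{\pi\in S_n}\mathrm{weight}(\pi)$, a polynomial in $q,x_1,\dots,x_n$ (so $P_n(q;1,\dots,1)=\sum_{\pi\in S_n}q^{N_{[1,2,3]}(\pi)}$). -}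

module Defs where

open import Level using (Level)
open import Data.Bool using (Bool; true; false; if_then_else_; _∧_)
open import Data.Nat using (ℕ; zero; suc; _<ᵇ_; _≡ᵇ_)
open import Data.Fin using (Fin; zero; suc; toℕ; inject₁)
open import Data.List using (List; []; _∷_; map; concatMap; allFin; foldr; filter)
open import Data.Nat.ListAction using (sum)
open import Algebra.Bundles using (CommutativeSemiring)

allFuns : {A : Set} → List A → (m : ℕ) → List (Fin m → A)
allFuns as zero    = (λ ()) ∷ []
allFuns as (suc m) =
  concatMap (λ a → map (λ f → λ { zero → a ; (suc j) → f j }) (allFuns as m)) as

countFin : (n : ℕ) → (Fin n → ℕ) → ℕ
countFin n f = sum (map f (allFin n))

b2n : Bool → ℕ
b2n true  = 1
b2n false = 0

_<F_ : {n : ℕ} → Fin n → Fin n → Bool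
i <F j = toℕ i <ᵇ toℕ j

_≡F_ : {n : ℕ} → Fin n → Fin n → Bool
i ≡F j = toℕ i ≡ᵇ toℕ j

isPerm : {n : ℕ} → (Fin n → Fin n) → Bool
isPerm {n} π =
  countFin n (λ a → countFin n (λ b →
    b2n ((a <F b) ∧ (π a ≡F π b)))) ≡ᵇ 0

Sym : (n : ℕ) → List (Fin n → Fin n)
Sym n = filter (λ π → Data.Bool._≟_ (isPerm π) true) (allFuns (allFin n) n)
  where import Data.Bool

N123 : {n : ℕ} → (Fin n → Fin n) → ℕ
N123 {n} π = countFin n (λ a → countFin n (λ b → countFin n (λ c →
  b2n ((a <F b) ∧ (b <F c) ∧ (π a <F π b) ∧ (π b <F π c)))))

expo : {n : ℕ} → (Fin n → Fin n) → Fin n → ℕ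
expo {n} π i = countFin n (λ a → countFin n (λ b →
  b2n ((a <F b) ∧ (π a ≡F i) ∧ (i <F π b))))

module _ {c ℓ : Level} (R : CommutativeSemiring c ℓ) where
  open CommutativeSemiring R

  pow : Carrier → ℕ → Carrier
  pow x zero    = 1#
  pow x (suc k) = x * pow x k

  ΣR : {A : Set} → List A → (A → Carrier) → Carrier
  ΣR as f = foldr (λ a r → f a + r) 0# (as)

  ΠFin : (n : ℕ) → (Fin n → Carrier) → Carrier
  ΠFin n f = foldr (λ i r → f i * r) 1# (allFin n)

  weight : {n : ℕ} → Carrier → (Fin n → Carrier) → (Fin n → Fin n) → Carrier
  weight {n} q x π = pow q (N123 π) * ΠFin n (λ i → pow (x i) (expo π i))

  P : (n : ℕ) → Carrier → (Fin n → Carrier) → Carrier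
  P n q x = ΣR (Sym n) (weight q x)

  -- the argument list (x_1,…,x_{i-1}, q x_{i+1}, …, q x_n) (0-based i)
  shiftArgs : {n : ℕ} → Carrier → (Fin (suc n) → Carrier) → Fin (suc n) → Fin n → Carrier
  shiftArgs q x i j = if toℕ j <ᵇ toℕ i then x (inject₁ j) else q * x (suc j)

module Submission where

-- Split π ∈ S(n+1) as π = i ◃ (punchIn i ∘ h): its first value i followed by a permutation h ∈ S n,
-- re-indexed to skip i; this is a bijection S(n+1) ≅ Fin (n+1) × S n. The 123-patterns of π avoiding
-- position 0 are those of h, and those starting there are the ascents h b < h c whose lower value h b
-- is ≥ i, so the factor q they contribute per ascent from a value w ≥ i is absorbed by replacing the
-- weight x_{w+1} of that value by q x_{w+1}. The value i itself lies below exactly the n − i values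
-- after it, giving x_i^(n−i), and the remaining x-exponents of π are those of h.

open import Defs
open import Level using (Level)
open import Algebra.Bundles using (CommutativeSemiring)
open import Data.Bool as Bool using (Bool; true; false; not; _∧_; T; if_then_else_)
open import Data.Bool.Properties using (T-∧; T-≡; ∧-zeroʳ)
import Data.Nat
open Data.Nat using (ℕ; zero; suc; _∸_; _<ᵇ_; _≡ᵇ_)
import Data.Nat.Properties as ℕₚ
open ℕₚ using (+-*-semiring)
open import Data.Fin as Fin using (Fin; zero; suc; toℕ; punchIn; punchOut)
open import Data.Fin.Properties using (<-cmp; punchOut-injective; injective⇒≤; any?; _≟_)
open import Data.Fin.Permutation using (Permutation′; permutation)
open import Data.List as List using (List; []; _∷_; _++_; tabulate; allFin; map; concatMap; filter)
open import Data.List.Properties using (map-tabulate)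
open import Data.Product using (∃; _,_; proj₁; proj₂)
open import Data.Vec.Functional as Vector using () renaming (_∷_ to _◃_)
open import Data.Vec.Functional.Properties using (∷-cong)
open import Function using (_∘_; id; Injective; Equivalence)
open import Relation.Binary.Definitions using (tri<; tri≈; tri>)
open import Relation.Binary.PropositionalEquality as ≡ using (_≡_; _≢_; _≗_)
open import Relation.Binary.Core using (_Preserves_⟶_)
open import Relation.Nullary using (yes; no; contradiction)

foldr-tabulate : ∀ {a b c} {A : Set a} {B : Set b} {C : Set c}
  (_∙_ : B → C → C) (e : C) (f : A → B) {n} (k : Fin n → A) →
  List.foldr (λ a r → f a ∙ r) e (tabulate k) ≡ Vector.foldr _∙_ e (f ∘ k)
foldr-tabulate _∙_ e f {zero}  k = ≡.refl
foldr-tabulate _∙_ e f {suc n} k = ≡.cong (f (k zero) ∙_) (foldr-tabulate _∙_ e f (k ∘ suc))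

injective⇒preimage : ∀ {n} {h : Fin n → Fin n} → Injective _≡_ _≡_ h → ∀ w → ∃ λ b → h b ≡ w
injective⇒preimage {suc m} {h} inj w with any? (λ b → h b ≟ w)
... | yes found  = found
... | no  missed = contradiction (injective⇒≤ punchOut∘h-injective) (ℕₚ.n≮n m)
  where
  w≢h : ∀ b → w ≢ h b
  w≢h b w≡hb = missed (b , ≡.sym w≡hb)
  punchOut∘h-injective : Injective _≡_ _≡_ (λ b → punchOut (w≢h b))
  punchOut∘h-injective = inj ∘ punchOut-injective (w≢h _) (w≢h _)

injective⇒permutation : ∀ {n} {h : Fin n → Fin n} → Injective _≡_ _≡_ h → Permutation′ n
injective⇒permutation {h = h} inj = permutation h (proj₁ ∘ preimage) (proj₂ ∘ preimage)
  (λ b → inj (proj₂ (preimage (h b))))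
  where preimage = injective⇒preimage inj

module Counting where

  open ≡ using (refl; sym; trans; cong; cong₂; module ≡-Reasoning)
  open Data.Nat using (_+_; _*_)
  open import Algebra.Properties.Semiring.Sum +-*-semiring

  countFin≡sum : ∀ n (f : Fin n → ℕ) → countFin n f ≡ sum f
  countFin≡sum n f = trans (cong (List.foldr _+_ 0) (map-tabulate id f)) (foldr-tabulate _+_ 0 id f)

  countFin²≡sum² : ∀ n (t : Fin n → Fin n → ℕ) →
    countFin n (λ a → countFin n (t a)) ≡ ∑[ a < n ] ∑[ b < n ] t a b
  countFin²≡sum² n t = trans (countFin≡sum n _) (sum-cong-≗ λ a → countFin≡sum n (t a))

  sum-zero : ∀ {n} {t : Fin n → ℕ} → (∀ i → t i ≡ 0) → sum t ≡ 0
  sum-zero {n} t≗0 = trans (sum-cong-≗ t≗0) (sum-replicate-zero n)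

  sum≡0⇒≡0 : ∀ {n} (t : Fin n → ℕ) → sum t ≡ 0 → ∀ i → t i ≡ 0
  sum≡0⇒≡0 t ∑t≡0 zero    = ℕₚ.m+n≡0⇒m≡0 (t zero) ∑t≡0
  sum≡0⇒≡0 t ∑t≡0 (suc i) = sum≡0⇒≡0 (t ∘ suc) (ℕₚ.m+n≡0⇒n≡0 (t zero) ∑t≡0) i

  sum-select : ∀ {n} (v : Fin n) (p : Fin n → Bool) → ∑[ w < n ] b2n ((v ≡F w) ∧ p w) ≡ b2n (p v)
  sum-select {suc n} zero    p = trans (cong (b2n (p zero) +_) (sum-replicate-zero n)) (ℕₚ.+-identityʳ _)
  sum-select {suc n} (suc v) p = sum-select v (p ∘ suc)

  _≤ᶠ_ : ∀ {n} → ℕ → Fin n → Bool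
  t ≤ᶠ w = not (toℕ w <ᵇ t)

  sum-≤ᶠ : ∀ n t → ∑[ w < n ] b2n (t ≤ᶠ w) ≡ n ∸ t
  sum-≤ᶠ zero    t       = sym (ℕₚ.0∸n≡0 t)
  sum-≤ᶠ (suc n) zero    = cong suc (sum-≤ᶠ n zero)
  sum-≤ᶠ (suc n) (suc t) = sum-≤ᶠ n t

  ≡ᵇ0-+ : ∀ x y → ((x + y) ≡ᵇ 0) ≡ (x ≡ᵇ 0) ∧ (y ≡ᵇ 0)
  ≡ᵇ0-+ zero    y = refl
  ≡ᵇ0-+ (suc x) y = refl

  b2n≡ᵇ0 : ∀ x → (b2n x ≡ᵇ 0) ≡ not x
  b2n≡ᵇ0 true  = refl
  b2n≡ᵇ0 false = refl

  b2n-∧ : ∀ x y → b2n (x ∧ y) ≡ b2n x * b2n y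
  b2n-∧ true  y = sym (ℕₚ.+-identityʳ (b2n y))
  b2n-∧ false y = refl

  T⇒b2n≢0 : ∀ {x} → T x → b2n x ≢ 0
  T⇒b2n≢0 {true} _ ()

  ∧-swap : ∀ x y z u → x ∧ y ∧ z ∧ u ≡ z ∧ y ∧ x ∧ u
  ∧-swap true  true  true  u = refl
  ∧-swap true  true  false u = refl
  ∧-swap true  false true  u = refl
  ∧-swap true  false false u = refl
  ∧-swap false true  true  u = refl
  ∧-swap false true  false u = refl
  ∧-swap false false true  u = refl
  ∧-swap false false false u = refl

  ≡F-refl : ∀ {n} (i : Fin n) → (i ≡F i) ≡ true
  ≡F-refl zero    = refl
  ≡F-refl (suc i) = ≡F-refl i

  punchIn-<F : ∀ {n} (i : Fin (suc n)) (a b : Fin n) → (punchIn i a <F punchIn i b) ≡ (a <F b)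
  punchIn-<F zero    a       b       = refl
  punchIn-<F (suc i) zero    zero    = refl
  punchIn-<F (suc i) zero    (suc b) = refl
  punchIn-<F (suc i) (suc a) zero    = refl
  punchIn-<F (suc i) (suc a) (suc b) = punchIn-<F i a b

  punchIn-≡F : ∀ {n} (i : Fin (suc n)) (a b : Fin n) → (punchIn i a ≡F punchIn i b) ≡ (a ≡F b)
  punchIn-≡F zero    a       b       = refl
  punchIn-≡F (suc i) zero    zero    = refl
  punchIn-≡F (suc i) zero    (suc b) = refl
  punchIn-≡F (suc i) (suc a) zero    = refl
  punchIn-≡F (suc i) (suc a) (suc b) = punchIn-≡F i a b

  punchInᵢ≢F-i : ∀ {n} (i : Fin (suc n)) (a : Fin n) → (punchIn i a ≡F i) ≡ false
  punchInᵢ≢F-i zero    a       = refl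
  punchInᵢ≢F-i (suc i) zero    = refl
  punchInᵢ≢F-i (suc i) (suc a) = punchInᵢ≢F-i i a

  i≢F-punchInᵢ : ∀ {n} (i : Fin (suc n)) (a : Fin n) → (i ≡F punchIn i a) ≡ false
  i≢F-punchInᵢ zero    a       = refl
  i≢F-punchInᵢ (suc i) zero    = refl
  i≢F-punchInᵢ (suc i) (suc a) = i≢F-punchInᵢ i a

  i<F-punchInᵢ : ∀ {n} (i : Fin (suc n)) (a : Fin n) → (i <F punchIn i a) ≡ (toℕ i ≤ᶠ a)
  i<F-punchInᵢ zero    a       = refl
  i<F-punchInᵢ (suc i) zero    = refl
  i<F-punchInᵢ (suc i) (suc a) = i<F-punchInᵢ i a

  -- isPerm, N123 and expo for maps into any Fin k: the tail punchIn i ∘ h of a permutation is not an endomap.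
  module _ {n k : ℕ} where

    collisions : (Fin n → Fin k) → ℕ
    collisions f = ∑[ a < n ] ∑[ b < n ] b2n ((a <F b) ∧ (f a ≡F f b))

    occurrences123 : (Fin n → Fin k) → ℕ
    occurrences123 f = ∑[ a < n ] ∑[ b < n ] ∑[ c < n ]
      b2n ((a <F b) ∧ (b <F c) ∧ (f a <F f b) ∧ (f b <F f c))

    ascentsFrom : (Fin n → Fin k) → Fin k → ℕ
    ascentsFrom f v = ∑[ a < n ] ∑[ b < n ] b2n ((a <F b) ∧ (f a ≡F v) ∧ (v <F f b))

    collisionFree : (Fin n → Fin k) → Bool
    collisionFree f = collisions f ≡ᵇ 0

    avoids : Fin k → (Fin n → Fin k) → Bool
    avoids a f = ∑[ b < n ] b2n (a ≡F f b) ≡ᵇ 0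

    collisions-cong : ∀ {f g} → f ≗ g → collisions f ≡ collisions g
    collisions-cong f≗g = sum-cong-≗ λ a → sum-cong-≗ λ b →
      cong₂ (λ u v → b2n ((a <F b) ∧ (u ≡F v))) (f≗g a) (f≗g b)

    occurrences123-cong : ∀ {f g} → f ≗ g → occurrences123 f ≡ occurrences123 g
    occurrences123-cong {f} {g} f≗g = sum-cong-≗ λ a → sum-cong-≗ λ b → sum-cong-≗ λ c → trans
      (cong₂ (λ u v → b2n ((a <F b) ∧ (b <F c) ∧ (u <F v) ∧ (v <F f c))) (f≗g a) (f≗g b))
      (cong (λ w → b2n ((a <F b) ∧ (b <F c) ∧ (g a <F g b) ∧ (g b <F w))) (f≗g c))

    ascentsFrom-cong : ∀ {f g} → f ≗ g → ∀ v → ascentsFrom f v ≡ ascentsFrom g v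
    ascentsFrom-cong f≗g v = sum-cong-≗ λ a → sum-cong-≗ λ b →
      cong₂ (λ u w → b2n ((a <F b) ∧ (u ≡F v) ∧ (v <F w))) (f≗g a) (f≗g b)

    collisionFree-cong : ∀ {f g} → f ≗ g → collisionFree f ≡ collisionFree g
    collisionFree-cong f≗g = cong (_≡ᵇ 0) (collisions-cong f≗g)

    avoids-cong : ∀ a {f g} → f ≗ g → avoids a f ≡ avoids a g
    avoids-cong a f≗g = cong (_≡ᵇ 0) (sum-cong-≗ λ b → cong (λ z → b2n (a ≡F z)) (f≗g b))

  isPerm≡collisionFree : ∀ {n} (π : Fin n → Fin n) → isPerm π ≡ collisionFree π
  isPerm≡collisionFree {n} π = cong (_≡ᵇ 0) (countFin²≡sum² n λ a b → b2n ((a <F b) ∧ (π a ≡F π b)))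

  isPerm-cong : ∀ {n} {π π′ : Fin n → Fin n} → π ≗ π′ → isPerm π ≡ isPerm π′
  isPerm-cong {π = π} {π′} π≗π′ =
    trans (isPerm≡collisionFree π) (trans (collisionFree-cong π≗π′) (sym (isPerm≡collisionFree π′)))

  N123≡occurrences123 : ∀ {n} (π : Fin n → Fin n) → N123 π ≡ occurrences123 π
  N123≡occurrences123 {n} π = trans (countFin≡sum n _) (sum-cong-≗ λ a → countFin²≡sum² n λ b c →
    b2n ((a <F b) ∧ (b <F c) ∧ (π a <F π b) ∧ (π b <F π c)))

  expo≡ascentsFrom : ∀ {n} (π : Fin n → Fin n) i → expo π i ≡ ascentsFrom π i
  expo≡ascentsFrom {n} π i = countFin²≡sum² n λ a b → b2n ((a <F b) ∧ (π a ≡F i) ∧ (i <F π b))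

  collisionFree-◃ : ∀ {n k} (a : Fin k) (f : Fin n → Fin k) →
    collisionFree (a ◃ f) ≡ avoids a f ∧ collisionFree f
  collisionFree-◃ {n} a f = ≡ᵇ0-+ (∑[ b < n ] b2n (a ≡F f b)) (collisions f)

  avoids-◃ : ∀ {n k} (a b : Fin k) (f : Fin n → Fin k) → avoids a (b ◃ f) ≡ not (a ≡F b) ∧ avoids a f
  avoids-◃ {n} a b f = trans (≡ᵇ0-+ (b2n (a ≡F b)) (∑[ c < n ] b2n (a ≡F f c)))
    (cong (_∧ avoids a f) (b2n≡ᵇ0 (a ≡F b)))

  occurrences123-◃ : ∀ {n k} (a : Fin k) (f : Fin n → Fin k) →
    occurrences123 (a ◃ f)
      ≡ ∑[ b < n ] ∑[ c < n ] b2n ((b <F c) ∧ (a <F f b) ∧ (f b <F f c)) + occurrences123 f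
  occurrences123-◃ {n} a f = cong₂ _+_
    (cong (_+ ∑[ b < n ] ∑[ c < n ] b2n ((b <F c) ∧ (a <F f b) ∧ (f b <F f c)))
      (sum-replicate-zero (suc n)))
    (sum-cong-≗ λ b → cong₂ _+_ (sum-replicate-zero (suc n)) (sum-cong-≗ λ c →
      cong (λ z → b2n z + ∑[ d < n ] b2n ((b <F c) ∧ (c <F d) ∧ (f b <F f c) ∧ (f c <F f d)))
        (∧-zeroʳ (b <F c))))

  collisions-punchIn : ∀ {n k} (i : Fin (suc k)) (f : Fin n → Fin k) →
    collisions (punchIn i ∘ f) ≡ collisions f
  collisions-punchIn i f = sum-cong-≗ λ a → sum-cong-≗ λ b →
    cong (λ z → b2n ((a <F b) ∧ z)) (punchIn-≡F i (f a) (f b))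

  collisionFree-punchIn : ∀ {n k} (i : Fin (suc k)) (f : Fin n → Fin k) →
    collisionFree (punchIn i ∘ f) ≡ collisionFree f
  collisionFree-punchIn i f = cong (_≡ᵇ 0) (collisions-punchIn i f)

  occurrences123-punchIn : ∀ {n k} (i : Fin (suc k)) (f : Fin n → Fin k) →
    occurrences123 (punchIn i ∘ f) ≡ occurrences123 f
  occurrences123-punchIn i f = sum-cong-≗ λ a → sum-cong-≗ λ b → sum-cong-≗ λ c →
    cong₂ (λ u v → b2n ((a <F b) ∧ (b <F c) ∧ u ∧ v)) (punchIn-<F i (f a) (f b)) (punchIn-<F i (f b) (f c))

  ascentsFrom-punchIn : ∀ {n k} (i : Fin (suc k)) (f : Fin n → Fin k) w →
    ascentsFrom (punchIn i ∘ f) (punchIn i w) ≡ ascentsFrom f w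
  ascentsFrom-punchIn i f w = sum-cong-≗ λ a → sum-cong-≗ λ b →
    cong₂ (λ u v → b2n ((a <F b) ∧ u ∧ v)) (punchIn-≡F i (f a) w) (punchIn-<F i w (f b))

  ascentsFrom-punchIn-self : ∀ {n k} (i : Fin (suc k)) (f : Fin n → Fin k) →
    ascentsFrom (punchIn i ∘ f) i ≡ 0
  ascentsFrom-punchIn-self i f = sum-zero λ a → sum-zero λ b → trans
    (cong (λ z → b2n ((a <F b) ∧ z ∧ (i <F punchIn i (f b)))) (punchInᵢ≢F-i i (f a)))
    (cong b2n (∧-zeroʳ (a <F b)))

  collision⇒collisions≢0 : ∀ {n k} {f : Fin n → Fin k} {a b} → a Fin.< b → f a ≡ f b → collisions f ≢ 0
  collision⇒collisions≢0 {f = f} {a} {b} a<b fa≡fb none =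
    T⇒b2n≢0 (Equivalence.from T-∧ (ℕₚ.<⇒<ᵇ a<b , ℕₚ.≡⇒≡ᵇ _ _ (cong toℕ fa≡fb)))
      (sum≡0⇒≡0 _ (sum≡0⇒≡0 _ none a) b)

  collisions≡0⇒injective : ∀ {n k} {f : Fin n → Fin k} → collisions f ≡ 0 → Injective _≡_ _≡_ f
  collisions≡0⇒injective none {a} {b} fa≡fb with <-cmp a b
  ... | tri< a<b _ _ = contradiction none (collision⇒collisions≢0 a<b fa≡fb)
  ... | tri≈ _ a≡b _ = a≡b
  ... | tri> _ _ b<a = contradiction none (collision⇒collisions≢0 b<a (sym fa≡fb))

  collisionFree⇒injective : ∀ {n k} {f : Fin n → Fin k} → collisionFree f ≡ true → Injective _≡_ _≡_ f
  collisionFree⇒injective {f = f} free =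
    collisions≡0⇒injective (ℕₚ.≡ᵇ⇒≡ (collisions f) 0 (Equivalence.from T-≡ free))

  sum-guard-ascentsFrom : ∀ {n k} (p : Fin k → Bool) (f : Fin n → Fin k) →
    ∑[ w < k ] (b2n (p w) * ascentsFrom f w)
      ≡ ∑[ a < n ] ∑[ b < n ] b2n ((a <F b) ∧ p (f a) ∧ (f a <F f b))
  sum-guard-ascentsFrom {n} {k} p f = begin
    ∑[ w < k ] (b2n (p w) * ascentsFrom f w)
      ≡⟨ sum-cong-≗ (λ w → trans (*-distribˡ-sum (b2n (p w)) (λ a → ∑[ b < n ] pair w a b))
                                 (sum-cong-≗ λ a → *-distribˡ-sum (b2n (p w)) (pair w a))) ⟩
    ∑[ w < k ] ∑[ a < n ] ∑[ b < n ] term w a b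
      ≡⟨ ∑-comm (λ w a → ∑[ b < n ] term w a b) ⟩
    ∑[ a < n ] ∑[ w < k ] ∑[ b < n ] term w a b
      ≡⟨ sum-cong-≗ (λ a → ∑-comm (λ w b → term w a b)) ⟩
    ∑[ a < n ] ∑[ b < n ] ∑[ w < k ] term w a b
      ≡⟨ sum-cong-≗ (λ a → sum-cong-≗ λ b → select a b) ⟩
    ∑[ a < n ] ∑[ b < n ] b2n ((a <F b) ∧ p (f a) ∧ (f a <F f b)) ∎
    where
    open ≡-Reasoning
    pair term : Fin k → Fin n → Fin n → ℕ
    pair w a b = b2n ((a <F b) ∧ (f a ≡F w) ∧ (w <F f b))
    term w a b = b2n (p w) * pair w a b
    select : ∀ a b → ∑[ w < k ] term w a b ≡ b2n ((a <F b) ∧ p (f a) ∧ (f a <F f b))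
    select a b = trans
      (sum-cong-≗ λ w → trans (sym (b2n-∧ (p w) _)) (cong b2n (∧-swap (p w) (a <F b) (f a ≡F w) (w <F f b))))
      (sum-select (f a) λ w → (a <F b) ∧ p w ∧ (w <F f b))

  module _ {n} (i : Fin (suc n)) (h : Fin n → Fin n) where

    occurrences123-◃-punchIn : occurrences123 (i ◃ punchIn i ∘ h)
      ≡ ∑[ w < n ] (b2n (toℕ i ≤ᶠ w) * ascentsFrom h w) + occurrences123 h
    occurrences123-◃-punchIn = begin
      occurrences123 (i ◃ punchIn i ∘ h)
        ≡⟨ occurrences123-◃ i (punchIn i ∘ h) ⟩
      ∑[ b < n ] ∑[ c < n ] b2n ((b <F c) ∧ (i <F punchIn i (h b)) ∧ (punchIn i (h b) <F punchIn i (h c)))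
        + occurrences123 (punchIn i ∘ h)
        ≡⟨ cong₂ _+_ (sum-cong-≗ λ b → sum-cong-≗ λ c → cong₂ (λ u v → b2n ((b <F c) ∧ u ∧ v))
                        (i<F-punchInᵢ i (h b)) (punchIn-<F i (h b) (h c)))
                     (occurrences123-punchIn i h) ⟩
      ∑[ b < n ] ∑[ c < n ] b2n ((b <F c) ∧ (toℕ i ≤ᶠ h b) ∧ (h b <F h c)) + occurrences123 h
        ≡⟨ cong (_+ occurrences123 h) (sym (sum-guard-ascentsFrom (toℕ i ≤ᶠ_) h)) ⟩
      ∑[ w < n ] (b2n (toℕ i ≤ᶠ w) * ascentsFrom h w) + occurrences123 h ∎
      where open ≡-Reasoning

    ascentsFrom-◃-punchIn : ∀ w → ascentsFrom (i ◃ punchIn i ∘ h) (punchIn i w) ≡ ascentsFrom h w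
    ascentsFrom-◃-punchIn w = cong₂ _+_
      (sum-zero λ b → cong (λ z → b2n (z ∧ (punchIn i w <F punchIn i (h b)))) (i≢F-punchInᵢ i w))
      (ascentsFrom-punchIn i h w)

    -- h is a bijection, so there are as many b with h b ≥ i as values w ≥ i.
    ascentsFrom-◃-punchIn-self : Injective _≡_ _≡_ h → ascentsFrom (i ◃ punchIn i ∘ h) i ≡ n ∸ toℕ i
    ascentsFrom-◃-punchIn-self inj = begin
      ascentsFrom (i ◃ punchIn i ∘ h) i
        ≡⟨⟩
      ∑[ b < n ] b2n ((i ≡F i) ∧ (i <F punchIn i (h b))) + ascentsFrom (punchIn i ∘ h) i
        ≡⟨ cong₂ _+_ (sum-cong-≗ λ b → cong₂ (λ u v → b2n (u ∧ v)) (≡F-refl i) (i<F-punchInᵢ i (h b)))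
                     (ascentsFrom-punchIn-self i h) ⟩
      ∑[ b < n ] b2n (toℕ i ≤ᶠ h b) + 0
        ≡⟨ ℕₚ.+-identityʳ _ ⟩
      ∑[ b < n ] b2n (toℕ i ≤ᶠ h b)
        ≡⟨ sym (∑-permute (λ w → b2n (toℕ i ≤ᶠ w)) (injective⇒permutation inj)) ⟩
      ∑[ w < n ] b2n (toℕ i ≤ᶠ w)
        ≡⟨ sum-≤ᶠ n (toℕ i) ⟩
      n ∸ toℕ i ∎
      where open ≡-Reasoning

open Counting

module _ {c ℓ : Level} (R : CommutativeSemiring c ℓ) where

  open CommutativeSemiring R hiding (zero)
  open import Algebra.Properties.CommutativeSemiring.Exp R using (_^_; ^-congˡ; ^-homo-*; ^-distrib-*; ^-assocʳ)
  open import Algebra.Properties.CommutativeMonoid.Sum +-commutativeMonoid using (sum; sum-syntax)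
  open import Algebra.Properties.CommutativeMonoid.Sum *-commutativeMonoid
    using () renaming (sum to ∏; sum-cong-≗ to ∏-cong-≗; sum-cong-≋ to ∏-cong; sum-remove to ∏-remove; ∑-distrib-+ to ∏-distrib-*)
  import Algebra.Properties.Semiring.Sum +-*-semiring as ℕ∑
  open Data.Nat using () renaming (_+_ to _+ℕ_; _*_ to _*ℕ_)
  open import Algebra.Solver.CommutativeMonoid *-commutativeMonoid using (solve; _⊕_; _⊜_)
  open import Relation.Binary.Reasoning.Setoid setoid

  guard : Bool → Carrier → Carrier
  guard b x = if b then x else 0#

  guard-cong : ∀ {b b′ x y} → b ≡ b′ → x ≈ y → guard b x ≈ guard b′ y
  guard-cong {true}  ≡.refl x≈y = x≈y
  guard-cong {false} ≡.refl _   = refl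

  guard-∧ : ∀ b b′ x → guard (b ∧ b′) x ≡ guard b (guard b′ x)
  guard-∧ true  b′ x = ≡.refl
  guard-∧ false b′ x = ≡.refl

  ΣR-cong : ∀ {A : Set} (xs : List A) {f g : A → Carrier} → (∀ a → f a ≈ g a) → ΣR R xs f ≈ ΣR R xs g
  ΣR-cong []       f≈g = refl
  ΣR-cong (a ∷ xs) f≈g = +-cong (f≈g a) (ΣR-cong xs f≈g)

  ΣR-++ : ∀ {A : Set} (xs ys : List A) (f : A → Carrier) → ΣR R (xs ++ ys) f ≈ ΣR R xs f + ΣR R ys f
  ΣR-++ []       ys f = sym (+-identityˡ _)
  ΣR-++ (a ∷ xs) ys f = trans (+-congˡ (ΣR-++ xs ys f)) (sym (+-assoc _ _ _))

  ΣR-concatMap : ∀ {A B : Set} (k : A → List B) (xs : List A) (f : B → Carrier) →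
    ΣR R (concatMap k xs) f ≈ ΣR R xs (λ a → ΣR R (k a) f)
  ΣR-concatMap k []       f = refl
  ΣR-concatMap k (a ∷ xs) f = trans (ΣR-++ (k a) (concatMap k xs) f) (+-congˡ (ΣR-concatMap k xs f))

  ΣR-map : ∀ {A B : Set} (φ : A → B) (xs : List A) (f : B → Carrier) → ΣR R (map φ xs) f ≡ ΣR R xs (f ∘ φ)
  ΣR-map φ []       f = ≡.refl
  ΣR-map φ (a ∷ xs) f = ≡.cong (f (φ a) +_) (ΣR-map φ xs f)

  ΣR-*ˡ : ∀ {A : Set} (xs : List A) x (f : A → Carrier) → ΣR R xs (λ a → x * f a) ≈ x * ΣR R xs f
  ΣR-*ˡ []       x f = sym (zeroʳ x)
  ΣR-*ˡ (a ∷ xs) x f = trans (+-congˡ (ΣR-*ˡ xs x f)) (sym (distribˡ x _ _))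

  ΣR-guard : ∀ {A : Set} (xs : List A) b (f : A → Carrier) → ΣR R xs (λ a → guard b (f a)) ≈ guard b (ΣR R xs f)
  ΣR-guard xs       true  f = refl
  ΣR-guard []       false f = refl
  ΣR-guard (a ∷ xs) false f = trans (+-identityˡ _) (ΣR-guard xs false f)

  ΣR-filter : ∀ {A : Set} (p : A → Bool) (xs : List A) (f : A → Carrier) →
    ΣR R (filter (λ a → p a Bool.≟ true) xs) f ≈ ΣR R xs (λ a → guard (p a) (f a))
  ΣR-filter p []       f = refl
  ΣR-filter p (a ∷ xs) f with p a
  ... | true  = +-congˡ (ΣR-filter p xs f)
  ... | false = trans (ΣR-filter p xs f) (sym (+-identityˡ _))

  ΣR-filter-cong : ∀ {A : Set} (p : A → Bool) (xs : List A) {f g : A → Carrier} →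
    (∀ a → p a ≡ true → f a ≈ g a) →
    ΣR R (filter (λ a → p a Bool.≟ true) xs) f ≈ ΣR R (filter (λ a → p a Bool.≟ true) xs) g
  ΣR-filter-cong p []       f≈g = refl
  ΣR-filter-cong p (a ∷ xs) f≈g with p a in pa
  ... | true  = +-cong (f≈g a pa) (ΣR-filter-cong p xs f≈g)
  ... | false = ΣR-filter-cong p xs f≈g

  ΣR-allFin : ∀ n (f : Fin n → Carrier) → ΣR R (allFin n) f ≡ sum f
  ΣR-allFin n f = foldr-tabulate _+_ 0# f id

  sum-punchIn : ∀ {k} (i : Fin (suc k)) (f : Fin (suc k) → Carrier) →
    ∑[ b < suc k ] guard (not (i ≡F b)) (f b) ≈ ∑[ c < k ] f (punchIn i c)
  sum-punchIn         zero    f = +-identityˡ _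
  sum-punchIn {suc k} (suc i) f = +-congˡ (sum-punchIn i (f ∘ suc))

  -- allFuns builds its maps with a pattern-matching λ that agrees with a ◃ f only pointwise.
  ΣR-allFuns-suc : ∀ {A : Set} (as : List A) m (G : (Fin (suc m) → A) → Carrier) → G Preserves _≗_ ⟶ _≈_ →
    ΣR R (allFuns as (suc m)) G ≈ ΣR R as (λ a → ΣR R (allFuns as m) (λ f → G (a ◃ f)))
  ΣR-allFuns-suc as m G G-cong = trans (ΣR-concatMap _ as G) (ΣR-cong as λ a →
    trans (reflexive (ΣR-map _ (allFuns as m) G)) (ΣR-cong (allFuns as m) λ f → G-cong (∷-cong ≡.refl λ _ → ≡.refl)))

  ΣR-allFuns-avoiding : ∀ {k} n (a : Fin (suc k)) (G : (Fin n → Fin (suc k)) → Carrier) → G Preserves _≗_ ⟶ _≈_ →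
    ΣR R (allFuns (allFin (suc k)) n) (λ f → guard (avoids a f) (G f))
      ≈ ΣR R (allFuns (allFin k) n) (λ h → G (punchIn a ∘ h))
  ΣR-allFuns-avoiding zero    a G G-cong = +-congʳ (G-cong λ ())
  ΣR-allFuns-avoiding {k} (suc n) a G G-cong = begin
    ΣR R (allFuns (allFin (suc k)) (suc n)) (λ f → guard (avoids a f) (G f))
      ≈⟨ ΣR-allFuns-suc (allFin (suc k)) n _ (λ f≗g → guard-cong (avoids-cong a f≗g) (G-cong f≗g)) ⟩
    ΣR R (allFin (suc k)) (λ b → ΣR R (allFuns (allFin (suc k)) n) (λ f → guard (avoids a (b ◃ f)) (G (b ◃ f))))
      ≈⟨ ΣR-cong (allFin (suc k)) (λ b → trans
           (ΣR-cong (allFuns (allFin (suc k)) n) λ f →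
             reflexive (≡.trans (≡.cong (λ z → guard z (G (b ◃ f))) (avoids-◃ a b f))
                                (guard-∧ (not (a ≡F b)) (avoids a f) (G (b ◃ f)))))
           (ΣR-guard (allFuns (allFin (suc k)) n) _ _)) ⟩
    ΣR R (allFin (suc k)) (λ b → guard (not (a ≡F b)) (ΣR R (allFuns (allFin (suc k)) n) (λ f → guard (avoids a f) (G (b ◃ f)))))
      ≈⟨ ΣR-cong (allFin (suc k)) (λ b → guard-cong ≡.refl
           (ΣR-allFuns-avoiding n a (G ∘ (b ◃_)) λ f≗g → G-cong (∷-cong ≡.refl f≗g))) ⟩
    ΣR R (allFin (suc k)) (λ b → guard (not (a ≡F b)) (tails b))
      ≡⟨ ΣR-allFin (suc k) _ ⟩
    ∑[ b < suc k ] guard (not (a ≡F b)) (tails b)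
      ≈⟨ sum-punchIn a tails ⟩
    ∑[ c < k ] tails (punchIn a c)
      ≡⟨ ΣR-allFin k _ ⟨
    ΣR R (allFin k) (λ c → tails (punchIn a c))
      ≈⟨ ΣR-cong (allFin k) (λ c → ΣR-cong (allFuns (allFin k) n) λ h → G-cong (∷-cong ≡.refl λ _ → ≡.refl)) ⟩
    ΣR R (allFin k) (λ c → ΣR R (allFuns (allFin k) n) (λ h → G (punchIn a ∘ (c ◃ h))))
      ≈⟨ ΣR-allFuns-suc (allFin k) n (λ h → G (punchIn a ∘ h)) (λ f≗g → G-cong (≡.cong (punchIn a) ∘ f≗g)) ⟨
    ΣR R (allFuns (allFin k) (suc n)) (λ h → G (punchIn a ∘ h)) ∎
    where
    tails : Fin (suc k) → Carrier
    tails b = ΣR R (allFuns (allFin k) n) (λ h → G (b ◃ punchIn a ∘ h))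

  ΣR-Sym-suc : ∀ n (F : (Fin (suc n) → Fin (suc n)) → Carrier) → F Preserves _≗_ ⟶ _≈_ →
    ΣR R (Sym (suc n)) F ≈ ΣR R (allFin (suc n)) (λ a → ΣR R (Sym n) (λ h → F (a ◃ punchIn a ∘ h)))
  ΣR-Sym-suc n F F-cong = begin
    ΣR R (Sym (suc n)) F
      ≈⟨ ΣR-filter isPerm (allFuns (allFin (suc n)) (suc n)) F ⟩
    ΣR R (allFuns (allFin (suc n)) (suc n)) (λ π → guard (isPerm π) (F π))
      ≈⟨ ΣR-allFuns-suc (allFin (suc n)) n _ (λ {π} {π′} π≗π′ → guard-cong (isPerm-cong π≗π′) (F-cong π≗π′)) ⟩
    ΣR R (allFin (suc n)) (λ a → ΣR R (allFuns (allFin (suc n)) n) (λ f → guard (isPerm (a ◃ f)) (F (a ◃ f))))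
      ≈⟨ ΣR-cong (allFin (suc n)) (λ a → ΣR-cong (allFuns (allFin (suc n)) n) λ f → reflexive (≡.trans
           (≡.cong (λ z → guard z (F (a ◃ f))) (≡.trans (isPerm≡collisionFree (a ◃ f)) (collisionFree-◃ a f)))
           (guard-∧ (avoids a f) (collisionFree f) (F (a ◃ f))))) ⟩
    ΣR R (allFin (suc n)) (λ a → ΣR R (allFuns (allFin (suc n)) n) (λ f →
      guard (avoids a f) (guard (collisionFree f) (F (a ◃ f)))))
      ≈⟨ ΣR-cong (allFin (suc n)) (λ a → ΣR-allFuns-avoiding n a _ λ f≗g →
           guard-cong (collisionFree-cong f≗g) (F-cong (∷-cong ≡.refl f≗g))) ⟩
    ΣR R (allFin (suc n)) (λ a → ΣR R (allFuns (allFin n) n) (λ h →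
      guard (collisionFree (punchIn a ∘ h)) (F (a ◃ punchIn a ∘ h))))
      ≈⟨ ΣR-cong (allFin (suc n)) (λ a → trans
           (ΣR-cong (allFuns (allFin n) n) λ h → reflexive (≡.cong (λ z → guard z (F (a ◃ punchIn a ∘ h)))
             (≡.trans (collisionFree-punchIn a h) (≡.sym (isPerm≡collisionFree h)))))
           (sym (ΣR-filter isPerm (allFuns (allFin n) n) _))) ⟩
    ΣR R (allFin (suc n)) (λ a → ΣR R (Sym n) (λ h → F (a ◃ punchIn a ∘ h))) ∎

  pow≡^ : ∀ x k → pow R x k ≡ x ^ k
  pow≡^ x zero    = ≡.refl
  pow≡^ x (suc k) = ≡.cong (x *_) (pow≡^ x k)

  ΠFin≡∏ : ∀ n (f : Fin n → Carrier) → ΠFin R n f ≡ ∏ f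
  ΠFin≡∏ n f = foldr-tabulate _*_ 1# f id

  weight≡ : ∀ {n} q (x : Fin n → Carrier) π →
    weight R q x π ≡ q ^ occurrences123 π * ∏ (λ v → x v ^ ascentsFrom π v)
  weight≡ {n} q x π = ≡.cong₂ _*_ (≡.trans (pow≡^ q (N123 π)) (≡.cong (q ^_) (N123≡occurrences123 π)))
    (≡.trans (ΠFin≡∏ n _) (∏-cong-≗ λ v →
      ≡.trans (pow≡^ (x v) (expo π v)) (≡.cong (x v ^_) (expo≡ascentsFrom π v))))

  weight-cong : ∀ {n} q (x : Fin n → Carrier) → weight R q x Preserves _≗_ ⟶ _≈_
  weight-cong q x {π} {π′} π≗π′ = reflexive (≡.trans (weight≡ q x π) (≡.trans
    (≡.cong₂ _*_ (≡.cong (q ^_) (occurrences123-cong π≗π′))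
                 (∏-cong-≗ λ v → ≡.cong (x v ^_) (ascentsFrom-cong π≗π′ v)))
    (≡.sym (weight≡ q x π′))))

  shiftArgs-punchIn : ∀ {n} q (x : Fin (suc n) → Carrier) i (w : Fin n) →
    shiftArgs R q x i w ≈ q ^ b2n (toℕ i ≤ᶠ w) * x (punchIn i w)
  shiftArgs-punchIn q x zero    w       = *-congʳ (sym (*-identityʳ q))
  shiftArgs-punchIn q x (suc i) zero    = sym (*-identityˡ (x zero))
  shiftArgs-punchIn q x (suc i) (suc w) = shiftArgs-punchIn q (x ∘ suc) i w

  ^-homo-sum : ∀ {n} x (e : Fin n → ℕ) → x ^ ℕ∑.sum e ≈ ∏ (λ w → x ^ e w)
  ^-homo-sum {zero}  x e = refl
  ^-homo-sum {suc n} x e = trans (^-homo-* x (e zero) (ℕ∑.sum (e ∘ suc))) (*-congˡ (^-homo-sum x (e ∘ suc)))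

  ∏-^-* : ∀ {n} q (s e : Fin n → ℕ) (y : Fin n → Carrier) →
    ∏ (λ w → (q ^ s w * y w) ^ e w) ≈ q ^ ℕ∑.sum (λ w → s w *ℕ e w) * ∏ (λ w → y w ^ e w)
  ∏-^-* q s e y = begin
    ∏ (λ w → (q ^ s w * y w) ^ e w)
      ≈⟨ ∏-cong (λ w → trans (^-distrib-* (q ^ s w) (y w) (e w)) (*-congʳ (^-assocʳ q (s w) (e w)))) ⟩
    ∏ (λ w → q ^ (s w *ℕ e w) * y w ^ e w)
      ≈⟨ ∏-distrib-* (λ w → q ^ (s w *ℕ e w)) (λ w → y w ^ e w) ⟩
    ∏ (λ w → q ^ (s w *ℕ e w)) * ∏ (λ w → y w ^ e w)
      ≈⟨ *-congʳ (^-homo-sum q (λ w → s w *ℕ e w)) ⟨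
    q ^ ℕ∑.sum (λ w → s w *ℕ e w) * ∏ (λ w → y w ^ e w) ∎

  weight-◃-punchIn : ∀ {n} q (x : Fin (suc n) → Carrier) i (h : Fin n → Fin n) → isPerm h ≡ true →
    weight R q x (i ◃ punchIn i ∘ h) ≈ pow R (x i) (n ∸ toℕ i) * weight R q (shiftArgs R q x i) h
  weight-◃-punchIn {n} q x i h perm = begin
    weight R q x π
      ≡⟨ weight≡ q x π ⟩
    q ^ occurrences123 π * ∏ (λ v → x v ^ ascentsFrom π v)
      ≈⟨ *-congˡ (∏-remove {i = i} (λ v → x v ^ ascentsFrom π v)) ⟩
    q ^ occurrences123 π * (x i ^ ascentsFrom π i * ∏ (λ w → x (punchIn i w) ^ ascentsFrom π (punchIn i w)))
      ≡⟨ ≡.cong₂ (λ u v → q ^ u * v) (occurrences123-◃-punchIn i h)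
           (≡.cong₂ _*_ (≡.trans (≡.cong (x i ^_) (ascentsFrom-◃-punchIn-self i h injective))
                                 (≡.sym (pow≡^ (x i) (n ∸ toℕ i))))
                        (∏-cong-≗ λ w → ≡.cong (x (punchIn i w) ^_) (ascentsFrom-◃-punchIn i h w))) ⟩
    q ^ (ℕ∑.sum (λ w → s w *ℕ e w) +ℕ occurrences123 h) * (X * Y)
      ≈⟨ *-congʳ (^-homo-* q (ℕ∑.sum (λ w → s w *ℕ e w)) (occurrences123 h)) ⟩
    (q ^ ℕ∑.sum (λ w → s w *ℕ e w) * q ^ occurrences123 h) * (X * Y)
      ≈⟨ solve 4 (λ a b c d → (a ⊕ b) ⊕ (c ⊕ d) ⊜ c ⊕ (b ⊕ (a ⊕ d))) refl _ _ X Y ⟩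
    X * (q ^ occurrences123 h * (q ^ ℕ∑.sum (λ w → s w *ℕ e w) * Y))
      ≈⟨ *-congˡ (*-congˡ (∏-^-* q s e (x ∘ punchIn i))) ⟨
    X * (q ^ occurrences123 h * ∏ (λ w → (q ^ s w * x (punchIn i w)) ^ e w))
      ≈⟨ *-congˡ (*-congˡ (∏-cong λ w → ^-congˡ (e w) (shiftArgs-punchIn q x i w))) ⟨
    X * (q ^ occurrences123 h * ∏ (λ w → shiftArgs R q x i w ^ e w))
      ≡⟨ ≡.cong (X *_) (weight≡ q (shiftArgs R q x i) h) ⟨
    X * weight R q (shiftArgs R q x i) h ∎
    where
    π = i ◃ punchIn i ∘ h
    s e : Fin n → ℕ
    s w = b2n (toℕ i ≤ᶠ w)
    e = ascentsFrom h
    X Y : Carrier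
    X = pow R (x i) (n ∸ toℕ i)
    Y = ∏ (λ w → x (punchIn i w) ^ e w)
    injective : Injective _≡_ _≡_ h
    injective = collisionFree⇒injective (≡.trans (≡.sym (isPerm≡collisionFree h)) perm)

mainTheorem1 : {c ℓ : Level} (R : CommutativeSemiring c ℓ) (n : ℕ)
    (q : CommutativeSemiring.Carrier R) (x : Fin (suc n) → CommutativeSemiring.Carrier R) →
    CommutativeSemiring._≈_ R (P R (suc n) q x)
    (ΣR R (allFin (suc n)) (λ i →
    CommutativeSemiring._*_ R (pow R (x i) (n ∸ toℕ i)) (P R n q (shiftArgs R q x i))))
mainTheorem1 R n q x = begin
  ΣR R (Sym (suc n)) (weight R q x)
    ≈⟨ ΣR-Sym-suc R n (weight R q x) (weight-cong R q x) ⟩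
  ΣR R (allFin (suc n)) (λ i → ΣR R (Sym n) (λ h → weight R q x (i ◃ punchIn i ∘ h)))
    ≈⟨ ΣR-cong R (allFin (suc n)) (λ i →
         ΣR-filter-cong R isPerm (allFuns (allFin n) n) (weight-◃-punchIn R q x i)) ⟩
  ΣR R (allFin (suc n)) (λ i → ΣR R (Sym n) (λ h → pow R (x i) (n ∸ toℕ i) * weight R q (shiftArgs R q x i) h))
    ≈⟨ ΣR-cong R (allFin (suc n)) (λ i → ΣR-*ˡ R (Sym n) _ _) ⟩
  ΣR R (allFin (suc n)) (λ i → pow R (x i) (n ∸ toℕ i) * P R n q (shiftArgs R q x i)) ∎
  where
  open CommutativeSemiring R using (_*_; setoid)
  open import Relation.Binary.Reasoning.Setoid setoid
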